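{- Let $S\subseteq\mathbb{N}_0$ be a numerical semigroup with genus $g$ and conductor $c$, and let $I$ be a proper ideal of $S$ which is maximum sparse, i.e. whose Frobenius number equals $2g-1+\#(S\setminus I)$. Then the leader of $I$ is at least $c$.
   Context: A numerical semigroup $S$ is a subset of $\mathbb{N}_0$ containing $0$, closed under addition, with finite complement. Its elements in increasing order are $\lambda_0=0<\lambda_1<\lambda_2<\cdots$; the genus is $g=\#(\mathbb{N}_0\setminus S)$ and the conductor $c$ is the smallest integer with $c+\mathbb{N}_0\subseteq S$. An ideal of $S$ is a subset $I\subseteq S$ with $I+S\subseteq I$; it is proper if $I\neq S$. The Frobenius number of an ideal $I$ is the largest integer not in $I$. It is known that the Frobenius number of any ideal $I$ is at most $2g-1+\#(S\setminus I)$; ideals attaining this bound are called maximum sparse. For $i\ge 0$ let $D(i)=\{\lambda_j\in S:\lambda_i-\lambda_j\in S\}$ and let $G(i)$ be the number of pairs of gaps (elements of $\mathbb{N}_0\setminus S$) adding up to $\lambda_i$. It is known that a proper ideal $I$ is maximum sparse if and only if $I=S\setminus D(i)$ for some $i$ with $G(i)=0$; in this case $\lambda_i$ is called the leader of $I$ (it is the largest element of $S\setminus I$). -}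

module Defs where

open import Data.Nat using (ℕ; zero; suc; _+_; _≤_; _<_)
open import Data.Bool using (Bool; true; false; not; _∧_; if_then_else_)
open import Data.Product using (Σ; _×_; ∃)
open import Relation.Binary.PropositionalEquality using (_≡_)

-- Subsets of ℕ₀ are represented by (decidable) characteristic functions ℕ → Bool.

count : (ℕ → Bool) → ℕ → ℕ
count P zero    = 0
count P (suc B) = (if P B then 1 else 0) + count P B

HasCard : (ℕ → Bool) → ℕ → Set
HasCard P k = Σ ℕ λ B → (∀ n → B ≤ n → P n ≡ false) × count P B ≡ k

IsNumericalSemigroup : (ℕ → Bool) → Set
IsNumericalSemigroup S =
  S 0 ≡ true
  × (∀ a b → S a ≡ true → S b ≡ true → S (a + b) ≡ true)
  × (Σ ℕ λ c → ∀ n → c ≤ n → S n ≡ true)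

IsConductor : (ℕ → Bool) → ℕ → Set
IsConductor S c =
  (∀ n → c ≤ n → S n ≡ true)
  × (∀ c′ → (∀ n → c′ ≤ n → S n ≡ true) → c ≤ c′)

IsGenus : (ℕ → Bool) → ℕ → Set
IsGenus S g = HasCard (λ n → not (S n)) g

IsIdeal : (ℕ → Bool) → (ℕ → Bool) → Set
IsIdeal S I =
  (∀ n → I n ≡ true → S n ≡ true)
  × (∀ a b → I a ≡ true → S b ≡ true → I (a + b) ≡ true)
  × (Σ ℕ λ n → I n ≡ true)

IsProper : (ℕ → Bool) → (ℕ → Bool) → Set
IsProper S I = Σ ℕ λ n → S n ≡ true × I n ≡ false

diff : (ℕ → Bool) → (ℕ → Bool) → ℕ → Bool
diff S I n = S n ∧ not (I n)

-- Frobenius number of I: largest integer not in I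
-- (for a proper ideal it is ≥ 0, so ℕ suffices)
IsFrobenius : (ℕ → Bool) → ℕ → Set
IsFrobenius I f = I f ≡ false × (∀ n → f < n → I n ≡ true)

IsLeader : (ℕ → Bool) → (ℕ → Bool) → ℕ → Set
IsLeader S I l =
  S l ≡ true × I l ≡ false
  × (∀ n → S n ≡ true → I n ≡ false → n ≤ l)

-- A numerical semigroup with conductor c = F + 1 has at least half of 0, …, F as gaps: since the
-- Frobenius number F is a gap, x and F − x are never both in S, so c ≤ 2g.  For a maximum sparse
-- ideal the Frobenius number f = 2g + #(S∖I) − 1 is then at least c.  But a leader l < c would
-- force f < c, because every element of ℕ∖I is either a gap (hence below c) or in S∖I (hence ≤ l).
module Submission where

open import Defs
open import Data.Nat using (ℕ; zero; suc; _+_; _*_; _∸_; _≤_; _<_; z≤n; s≤s; _<?_)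
open import Data.Nat.Properties
open import Data.Bool using (Bool; true; false; not; _∨_; if_then_else_)
open import Data.Product using (_,_)
open import Data.Sum using (inj₁; inj₂)
open import Data.Empty using (⊥-elim)
open import Relation.Nullary using (yes; no)
open import Function using (_∘_)
open import Relation.Binary.PropositionalEquality
open import Algebra.Properties.CommutativeSemigroup +-commutativeSemigroup using (x∙yz≈y∙xz)

indicator : Bool → ℕ
indicator b = if b then 1 else 0

indicator-∨ : ∀ a b → indicator (a ∨ b) ≤ indicator a + indicator b
indicator-∨ true  _ = s≤s z≤n
indicator-∨ false _ = ≤-refl

count-cong : ∀ {P Q : ℕ → Bool} n → (∀ x → x < n → P x ≡ Q x) → count P n ≡ count Q n
count-cong zero    _  = refl
count-cong (suc n) eq =
  cong₂ (λ b m → indicator b + m) (eq n ≤-refl) (count-cong n (λ x → eq x ∘ m<n⇒m<1+n))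

count-all : ∀ {P : ℕ → Bool} n → (∀ x → x < n → P x ≡ true) → count P n ≡ n
count-all {P} n all = trans (count-cong n all) (count-true n)
  where
  count-true : ∀ n → count (λ _ → true) n ≡ n
  count-true zero    = refl
  count-true (suc n) = cong suc (count-true n)

count-∨ : ∀ (P Q : ℕ → Bool) n → count (λ x → P x ∨ Q x) n ≤ count P n + count Q n
count-∨ P Q zero    = z≤n
count-∨ P Q (suc n) = begin
  indicator (P n ∨ Q n) + count (λ x → P x ∨ Q x) n
    ≤⟨ +-mono-≤ (indicator-∨ (P n) (Q n)) (count-∨ P Q n) ⟩
  (indicator (P n) + indicator (Q n)) + (count P n + count Q n)
    ≡⟨ +-assoc (indicator (P n)) _ _ ⟩
  indicator (P n) + (indicator (Q n) + (count P n + count Q n))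
    ≡⟨ cong (indicator (P n) +_) (x∙yz≈y∙xz (indicator (Q n)) (count P n) (count Q n)) ⟩
  indicator (P n) + (count P n + count Q (suc n))
    ≡⟨ +-assoc (indicator (P n)) _ _ ⟨
  count P (suc n) + count Q (suc n) ∎
  where open ≤-Reasoning

count-suc-shift : ∀ (P : ℕ → Bool) n → count P (suc n) ≡ indicator (P 0) + count (P ∘ suc) n
count-suc-shift P zero    = refl
count-suc-shift P (suc n) = begin
  indicator (P (suc n)) + count P (suc n)
    ≡⟨ cong (indicator (P (suc n)) +_) (count-suc-shift P n) ⟩
  indicator (P (suc n)) + (indicator (P 0) + count (P ∘ suc) n)
    ≡⟨ x∙yz≈y∙xz (indicator (P (suc n))) (indicator (P 0)) _ ⟩
  indicator (P 0) + count (P ∘ suc) (suc n) ∎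
  where open ≡-Reasoning

count-reverse : ∀ (P : ℕ → Bool) n → count (λ x → P (n ∸ suc x)) n ≡ count P n
count-reverse P zero    = refl
count-reverse P (suc n) = begin
  indicator (P (n ∸ n)) + count (λ x → P (n ∸ x)) n
    ≡⟨ cong₂ (λ b m → indicator b + m) (cong P (n∸n≡0 n))
             (count-cong n (λ x x<n → cong P (+-∸-assoc 1 x<n))) ⟩
  indicator (P 0) + count (λ x → P (suc (n ∸ suc x))) n
    ≡⟨ cong (indicator (P 0) +_) (count-reverse (P ∘ suc) n) ⟩
  indicator (P 0) + count (P ∘ suc) n
    ≡⟨ count-suc-shift P n ⟨
  count P (suc n) ∎
  where open ≡-Reasoning

count-mirror-cover : ∀ (P : ℕ → Bool) n
  → (∀ x → x < n → P x ∨ P (n ∸ suc x) ≡ true) → n ≤ 2 * count P n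
count-mirror-cover P n cover = begin
  n                                                 ≡⟨ count-all n cover ⟨
  count (λ x → P x ∨ P (n ∸ suc x)) n               ≤⟨ count-∨ P (λ x → P (n ∸ suc x)) n ⟩
  count P n + count (λ x → P (n ∸ suc x)) n         ≡⟨ cong (count P n +_) (count-reverse P n) ⟩
  count P n + count P n                             ≡⟨ cong (count P n +_) (+-identityʳ (count P n)) ⟨
  2 * count P n                                     ∎
  where open ≤-Reasoning

count-mono : ∀ (P : ℕ → Bool) {m n} → m ≤ n → count P m ≤ count P n
count-mono P {n = zero}  z≤n = ≤-refl
count-mono P {n = suc n} m≤1+n with m≤n⇒m<n∨m≡n m≤1+n
... | inj₁ (s≤s m≤n) = ≤-trans (count-mono P m≤n) (m≤n+m _ _)
... | inj₂ refl      = ≤-refl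

count-stable : ∀ (P : ℕ → Bool) {B} → (∀ n → B ≤ n → P n ≡ false)
  → ∀ {n} → B ≤ n → count P n ≡ count P B
count-stable P out {zero}  z≤n = refl
count-stable P out {suc n} B≤1+n with m≤n⇒m<n∨m≡n B≤1+n
... | inj₁ (s≤s B≤n) rewrite out n B≤n = count-stable P out B≤n
... | inj₂ refl      = refl

HasCard⇒count≤ : ∀ {P : ℕ → Bool} {k} → HasCard P k → ∀ n → count P n ≤ k
HasCard⇒count≤ {P} (B , out , refl) n with ≤-total n B
... | inj₁ n≤B = count-mono P n≤B
... | inj₂ B≤n = ≤-reflexive (count-stable P out B≤n)

HasCard⇒nonempty⇒1≤ : ∀ {P : ℕ → Bool} {k n} → HasCard P k → P n ≡ true → 1 ≤ k
HasCard⇒nonempty⇒1≤ {P} {n = n} card Pn =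
  ≤-trans (subst (λ b → 1 ≤ indicator b + count P n) (sym Pn) (s≤s z≤n)) (HasCard⇒count≤ card (suc n))

gap<conductor : ∀ {S c n} → IsConductor S c → S n ≡ false → n < c
gap<conductor {S} {c} {n} (above , _) Sn with n <? c
... | yes n<c = n<c
... | no n≮c with () ← trans (sym Sn) (above n (≮⇒≥ n≮c))

frobenius-gap : ∀ {S F} → IsConductor S (suc F) → S F ≡ false
frobenius-gap {S} {F} (above , least) with S F in SF
... | false = refl
... | true  = ⊥-elim (<-irrefl refl (least F above-F))
  where
  above-F : ∀ n → F ≤ n → S n ≡ true
  above-F n F≤n with m≤n⇒m<n∨m≡n F≤n
  ... | inj₁ F<n  = above n F<n
  ... | inj₂ refl = SF

conductor≤2*genus : ∀ {S g c} → IsNumericalSemigroup S → IsGenus S g → IsConductor S c → c ≤ 2 * g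
conductor≤2*genus {c = zero}  _ _ _ = z≤n
conductor≤2*genus {S} {g} {suc F} (_ , closed , _) genus conductor =
  ≤-trans (count-mirror-cover gap (suc F) mirror-gap) (*-monoʳ-≤ 2 (HasCard⇒count≤ genus (suc F)))
  where
  gap : ℕ → Bool
  gap n = not (S n)
  mirror-gap : ∀ x → x < suc F → gap x ∨ gap (F ∸ x) ≡ true
  mirror-gap x (s≤s x≤F) with S x in Sx | S (F ∸ x) in SF∸x
  ... | false | _     = refl
  ... | true  | false = refl
  ... | true  | true  with () ← trans (sym (frobenius-gap conductor))
                          (subst (λ n → S n ≡ true) (m+[n∸m]≡n x≤F) (closed x (F ∸ x) Sx SF∸x))

frobenius<conductor : ∀ {S I c f l} → IsConductor S c → IsFrobenius I f → IsLeader S I l → l < c → f < c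
frobenius<conductor {S} {f = f} conductor (If , _) (_ , _ , maximal) l<c with S f in Sf
... | true  = ≤-<-trans (maximal f Sf If) l<c
... | false = gap<conductor conductor Sf

lemma1 : (S I : ℕ → Bool) (g c k f l : ℕ)
    → IsNumericalSemigroup S → IsGenus S g → IsConductor S c
    → IsIdeal S I → IsProper S I
    → HasCard (diff S I) k → IsFrobenius I f
    → f ≡ 2 * g + k ∸ 1
    → IsLeader S I l
    → c ≤ l
lemma1 S I g c k f l semigroup genus conductor _ (p , Sp , Ip) card frobenius refl leader =
  ≮⇒≥ λ l<c → <-irrefl refl (<-≤-trans (frobenius<conductor conductor frobenius leader l<c) c≤f)
  where
  1≤k : 1 ≤ k
  1≤k = HasCard⇒nonempty⇒1≤ card p∈S∖I
    where
    p∈S∖I : diff S I p ≡ true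
    p∈S∖I rewrite Sp | Ip = refl
  c≤f : c ≤ 2 * g + k ∸ 1
  c≤f = begin
    c               ≤⟨ conductor≤2*genus semigroup genus conductor ⟩
    2 * g           ≤⟨ m≤m+n (2 * g) (k ∸ 1) ⟩
    2 * g + (k ∸ 1) ≡⟨ +-∸-assoc (2 * g) 1≤k ⟨
    2 * g + k ∸ 1   ∎
    where open ≤-Reasoning
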